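{- Let $F_n(x,y)$ denote the bivariate Fibonacci polynomials. For every integer $n\ge 3$, \[ \frac{\partial F_{n}(x,y)}{\partial y}=\sum_{i=0}^{\lfloor \frac{n-3}{2}\rfloor}(-1)^{i}(n-2-2i)\,F_{n-2-2i}(x,y)\,y^{i}. \]
   Context: The bivariate Fibonacci polynomials $F_n(x,y)\in\mathbb{Z}[x,y]$, $n\ge 0$, are defined by $F_0(x,y)=0$, $F_1(x,y)=1$ and $F_n(x,y)=xF_{n-1}(x,y)+yF_{n-2}(x,y)$ for $n\ge 2$. -}

module Defs where

open import Data.Nat using (ℕ; zero; suc)
import Data.Nat as ℕ
open import Data.Integer using (ℤ; +_; _+_; _*_)
open import Relation.Binary.PropositionalEquality using (_≡_)

-- A bivariate polynomial in ℤ[x,y], represented by its coefficient function: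
-- p a b is the coefficient of x^a y^b.  (All polynomials built below have
-- finite support.)  Two polynomials are equal iff all coefficients agree.
Poly : Set
Poly = ℕ → ℕ → ℤ

_≈P_ : Poly → Poly → Set
p ≈P q = ∀ a b → p a b ≡ q a b

infix 4 _≈P_

0P : Poly
0P _ _ = + 0

1P : Poly
1P zero zero = + 1
1P _    _    = + 0

_+P_ : Poly → Poly → Poly
(p +P q) a b = p a b + q a b

infixl 6 _+P_

_·P_ : ℤ → Poly → Poly
(c ·P p) a b = c * p a b

infixl 7 _·P_

xP* : Poly → Poly
xP* p zero    b = + 0
xP* p (suc a) b = p a b

yP* : Poly → Poly
yP* p a zero    = + 0
yP* p a (suc b) = p a b

yPow* : ℕ → Poly → Poly
yPow* zero    p = p
yPow* (suc i) p = yP* (yPow* i p)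

∂y : Poly → Poly
∂y p a b = + (suc b) * p a (suc b)

sumP : ℕ → (ℕ → Poly) → Poly
sumP zero    f = 0P
sumP (suc k) f = sumP k f +P f k

F : ℕ → Poly
F zero          = 0P
F (suc zero)    = 1P
F (suc (suc n)) = xP* (F (suc n)) +P yP* (F n)

module Submission where

-- Write F′ n for ∂F_n/∂y.  Differentiating F_{n+2} = x F_{n+1} + y F_n
-- with the product rule gives the recurrence
--   F′_{n+2} = x F′_{n+1} + F_n + y F′_n,
-- and from it, by induction on n, the key identity
--   F′_{n+2} + y F′_n = n F_n .
-- Solving the key identity for F′_{m+2} and iterating k times expresses
-- F′_{m+2k} as the first k terms of the claimed alternating sum plus the
-- remainder (-1)^k y^k F′_m.  Since F′_1 = F′_2 = 0, choosing m ∈ {1,2}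
-- with n = m + 2k (k = ⌊(n-3)/2⌋ + 1) makes the remainder vanish.

open import Defs
open import Data.Nat using (ℕ; zero; suc; _≤_; _∸_; ⌊_/2⌋; z≤n; s≤s)
import Data.Nat as ℕ
open import Data.Nat.Properties using (+-identityʳ; m+n∸n≡m)
import Data.Nat.Tactic.RingSolver as ℕSolver
open import Data.Integer using (ℤ; +_; -1ℤ; 0ℤ; 1ℤ; _^_; _+_; _*_)
import Data.Integer.Properties as ℤP
open import Data.Integer.Tactic.RingSolver using (solve-∀)
open import Data.Sum using (_⊎_; inj₁; inj₂)
import Data.Sum as Sum
open import Function using (_∘_)
open import Relation.Binary.PropositionalEquality
  using (_≡_; refl; sym; trans; cong; cong₂; module ≡-Reasoning)
open ≡-Reasoning

record IsLinear (f : Poly → Poly) : Set where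
  field
    cong-≈      : ∀ {p q} → p ≈P q → f p ≈P f q
    additive    : ∀ p q → f (p +P q) ≈P f p +P f q
    homogeneous : ∀ c p → f (c ·P p) ≈P c ·P f p

open IsLinear

∘-linear : ∀ {f g} → IsLinear f → IsLinear g → IsLinear (f ∘ g)
∘-linear {f} {g} lf lg = record
  { cong-≈      = λ e → cong-≈ lf (cong-≈ lg e)
  ; additive    = λ p q a b →
      trans (cong-≈ lf (additive lg p q) a b) (additive lf (g p) (g q) a b)
  ; homogeneous = λ c p a b →
      trans (cong-≈ lf (homogeneous lg c p) a b) (homogeneous lf c (g p) a b)
  }

maps-zero : ∀ {f p} → IsLinear f → p ≈P 0P → f p ≈P 0P
maps-zero {f} lf z a b = begin
  f _ a b            ≡⟨ cong-≈ lf z a b ⟩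
  f 0P a b           ≡⟨ cong-≈ lf (λ _ _ → refl) a b ⟩
  f (+ 0 ·P 0P) a b  ≡⟨ homogeneous lf (+ 0) 0P a b ⟩
  + 0 * f 0P a b     ≡⟨ ℤP.*-zeroˡ (f 0P a b) ⟩
  + 0                ∎

map-identity : ∀ {f p q c r} → IsLinear f → p +P q ≈P c ·P r →
               f p +P f q ≈P c ·P f r
map-identity {f} {p} {q} {c} {r} lf e a b = begin
  f p a b + f q a b  ≡⟨ sym (additive lf p q a b) ⟩
  f (p +P q) a b     ≡⟨ cong-≈ lf e a b ⟩
  f (c ·P r) a b     ≡⟨ homogeneous lf c r a b ⟩
  c * f r a b        ∎

x-linear : IsLinear xP*
x-linear = record { cong-≈ = cong-x ; additive = additive-x ; homogeneous = homogeneous-x }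
  where
  cong-x : ∀ {p q} → p ≈P q → xP* p ≈P xP* q
  cong-x e zero    b = refl
  cong-x e (suc a) b = e a b
  additive-x : ∀ p q → xP* (p +P q) ≈P xP* p +P xP* q
  additive-x p q zero    b = refl
  additive-x p q (suc a) b = refl
  homogeneous-x : ∀ c p → xP* (c ·P p) ≈P c ·P xP* p
  homogeneous-x c p zero    b = sym (ℤP.*-zeroʳ c)
  homogeneous-x c p (suc a) b = refl

y-linear : IsLinear yP*
y-linear = record { cong-≈ = cong-y ; additive = additive-y ; homogeneous = homogeneous-y }
  where
  cong-y : ∀ {p q} → p ≈P q → yP* p ≈P yP* q
  cong-y e a zero    = refl
  cong-y e a (suc b) = e a b
  additive-y : ∀ p q → yP* (p +P q) ≈P yP* p +P yP* q
  additive-y p q a zero    = refl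
  additive-y p q a (suc b) = refl
  homogeneous-y : ∀ c p → yP* (c ·P p) ≈P c ·P yP* p
  homogeneous-y c p a zero    = sym (ℤP.*-zeroʳ c)
  homogeneous-y c p a (suc b) = refl

yPow-linear : ∀ k → IsLinear (yPow* k)
yPow-linear zero    = record
  { cong-≈ = λ e → e ; additive = λ _ _ _ _ → refl ; homogeneous = λ _ _ _ _ → refl }
yPow-linear (suc k) = ∘-linear y-linear (yPow-linear k)

x-y-comm : ∀ p → xP* (yP* p) ≈P yP* (xP* p)
x-y-comm p zero    zero    = refl
x-y-comm p zero    (suc b) = refl
x-y-comm p (suc a) zero    = refl
x-y-comm p (suc a) (suc b) = refl

yPow-y-comm : ∀ k p → yPow* k (yP* p) ≈P yP* (yPow* k p)
yPow-y-comm zero    p = λ _ _ → refl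
yPow-y-comm (suc k) p = cong-≈ y-linear (yPow-y-comm k p)

∂y-additive : ∀ p q → ∂y (p +P q) ≈P ∂y p +P ∂y q
∂y-additive p q a b = ℤP.*-distribˡ-+ (+ suc b) (p a (suc b)) (q a (suc b))

∂y-x : ∀ p → ∂y (xP* p) ≈P xP* (∂y p)
∂y-x p zero    b = ℤP.*-zeroʳ (+ suc b)
∂y-x p (suc a) b = refl

∂y-y : ∀ p → ∂y (yP* p) ≈P p +P yP* (∂y p)
∂y-y p a zero    = trans (ℤP.*-identityˡ (p a 0)) (sym (ℤP.+-identityʳ (p a 0)))
∂y-y p a (suc b) =
  -- (b + 2) · c = c + (b + 1) · c for the coefficient c of x^a y^(b+1) in p
  trans (ℤP.*-distribʳ-+ (p a (suc b)) 1ℤ (+ suc b))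
        (cong (_+ + suc b * p a (suc b)) (ℤP.*-identityˡ (p a (suc b))))

F′ : ℕ → Poly
F′ n = ∂y (F n)

F′-rec : ∀ n → F′ (2 ℕ.+ n) ≈P xP* (F′ (1 ℕ.+ n)) +P (F n +P yP* (F′ n))
F′-rec n a b = trans (∂y-additive (xP* (F (1 ℕ.+ n))) (yP* (F n)) a b)
                     (cong₂ _+_ (∂y-x (F (1 ℕ.+ n)) a b) (∂y-y (F n) a b))

-- F_0, F_1 and F_2 = x do not involve y.
F′-0 : F′ 0 ≈P 0P
F′-0 a b = ℤP.*-zeroʳ (+ suc b)

F′-1 : F′ 1 ≈P 0P
F′-1 zero    b = ℤP.*-zeroʳ (+ suc b)
F′-1 (suc a) b = ℤP.*-zeroʳ (+ suc b)

F′-2 : F′ 2 ≈P 0P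
F′-2 a b = trans (F′-rec 0 a b)
  (cong₂ _+_ (maps-zero x-linear F′-1 a b)
             (cong (_+_ 0ℤ) (maps-zero y-linear F′-0 a b)))

regroup : ∀ A F₂ G B C E →
  (A + (F₂ + G)) + (B + (C + E)) ≡ ((A + B) + (G + E)) + (F₂ + C)
regroup = solve-∀

collect : ∀ N H C →
  ((1ℤ + N) * H + N * C) + ((H + C) + C) ≡ (1ℤ + (1ℤ + N)) * (H + C)
collect = solve-∀

key-identity : ∀ n → F′ (2 ℕ.+ n) +P yP* (F′ n) ≈P (+ n) ·P F n
key-identity zero a b =
  cong₂ _+_ (F′-2 a b) (maps-zero y-linear F′-0 a b)
key-identity (suc zero) a b = begin
  F′ 3 a b + yP* (F′ 1) a b
    ≡⟨ cong (_+ yP* (F′ 1) a b) (F′-rec 1 a b) ⟩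
  (xP* (F′ 2) a b + (F 1 a b + yP* (F′ 1) a b)) + yP* (F′ 1) a b
    ≡⟨ cong₂ (λ u v → (u + (F 1 a b + v)) + v)
             (maps-zero x-linear F′-2 a b) (maps-zero y-linear F′-1 a b) ⟩
  (0ℤ + (F 1 a b + 0ℤ)) + 0ℤ
    ≡⟨ drop-zeros (F 1 a b) ⟩
  1ℤ * F 1 a b ∎
  where
  drop-zeros : ∀ f → (0ℤ + (f + 0ℤ)) + 0ℤ ≡ 1ℤ * f
  drop-zeros = solve-∀
key-identity (suc (suc n)) a b = begin
  F′ (4 ℕ.+ n) a b + G
    ≡⟨ cong (_+ G) (F′-rec (2 ℕ.+ n) a b) ⟩
  (A + (F₂ + G)) + G
    ≡⟨ cong (_+_ (A + (F₂ + G))) G-expand ⟩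
  (A + (F₂ + G)) + (B + (C + E))
    ≡⟨ regroup A F₂ G B C E ⟩
  ((A + B) + (G + E)) + (F₂ + C)
    -- x times the key identity for n + 1, and y times the one for n
    ≡⟨ cong₂ (λ u v → (u + v) + (F₂ + C))
             (map-identity {c = + suc n} {r = F (1 ℕ.+ n)} x-linear (key-identity (suc n)) a b)
             (map-identity {c = + n} {r = F n} y-linear (key-identity n) a b) ⟩
  (+ suc n * H + + n * C) + ((H + C) + C)
    ≡⟨ collect (+ n) H C ⟩
  + suc (suc n) * F₂ ∎
  where
  A B C E G H F₂ : ℤ
  A  = xP* (F′ (3 ℕ.+ n)) a b
  B  = xP* (yP* (F′ (1 ℕ.+ n))) a b
  C  = yP* (F n) a b
  E  = yP* (yP* (F′ n)) a b
  G  = yP* (F′ (2 ℕ.+ n)) a b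
  H  = xP* (F (1 ℕ.+ n)) a b
  -- by the defining recurrence, F₂ is H + C definitionally
  F₂ = F (2 ℕ.+ n) a b
  -- y times the recurrence for F′_{n+2}
  G-expand : G ≡ B + (C + E)
  G-expand = trans (cong-≈ y-linear (F′-rec n) a b)
    (trans (additive y-linear _ _ a b)
           (cong₂ _+_ (sym (x-y-comm (F′ (1 ℕ.+ n)) a b))
                      (additive y-linear _ _ a b)))

term : ℕ → ℕ → Poly
term n i = ((-1ℤ ^ i) * (+ (n ∸ 2 ∸ 2 ℕ.* i))) ·P yPow* i (F (n ∸ 2 ∸ 2 ℕ.* i))

two-more : ∀ m k → m ℕ.+ 2 ℕ.* suc k ≡ 2 ℕ.+ (m ℕ.+ 2 ℕ.* k)
two-more = ℕSolver.solve-∀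

split-off : ∀ S c Y₂ Y₀ → S + c * Y₂ ≡ (S + c * (Y₂ + Y₀)) + (-1ℤ * c) * Y₀
split-off = solve-∀

-- Iterating  F′_{m+2} = m F_m - y F′_m  k times:
--   F′_{m+2k} = Σ_{i<k} term i + (-1)^k y^k F′_m .
telescope : ∀ m k n → n ≡ m ℕ.+ 2 ℕ.* k →
            F′ n ≈P sumP k (term n) +P (-1ℤ ^ k) ·P yPow* k (F′ m)
telescope m zero n n≡m a b = begin
  F′ n a b            ≡⟨ cong (λ j → F′ j a b) (trans n≡m (+-identityʳ m)) ⟩
  F′ m a b            ≡⟨ sym (ℤP.*-identityˡ (F′ m a b)) ⟩
  1ℤ * F′ m a b       ≡⟨ sym (ℤP.+-identityˡ (1ℤ * F′ m a b)) ⟩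
  0ℤ + 1ℤ * F′ m a b  ∎
telescope m (suc k) n n≡m+2k+2 a b = begin
  F′ n a b
    ≡⟨ telescope (2 ℕ.+ m) k n n≡m+2+2k a b ⟩
  S + c * Y₂
    ≡⟨ split-off S c Y₂ Y₀ ⟩
  (S + c * (Y₂ + Y₀)) + (-1ℤ * c) * Y₀
    ≡⟨ cong (λ u → (S + c * u) + (-1ℤ * c) * Y₀) shifted-identity ⟩
  (S + c * (+ m * Yf)) + (-1ℤ * c) * Y₀
    ≡⟨ cong (λ u → (S + u) + (-1ℤ * c) * Y₀) (sym (ℤP.*-assoc c (+ m) Yf)) ⟩
  (S + (c * + m) * Yf) + (-1ℤ * c) * Y₀
    ≡⟨ cong (λ j → (S + (c * + j) * yPow* k (F j) a b) + (-1ℤ * c) * Y₀)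
            (sym last-index) ⟩
  (S + term n k a b) + (-1ℤ * c) * Y₀ ∎
  where
  c S Y₂ Y₀ Yf : ℤ
  c  = -1ℤ ^ k
  S  = sumP k (term n) a b
  Y₂ = yPow* k (F′ (2 ℕ.+ m)) a b
  Y₀ = yPow* (suc k) (F′ m) a b
  Yf = yPow* k (F m) a b
  n≡m+2+2k : n ≡ (2 ℕ.+ m) ℕ.+ 2 ℕ.* k
  n≡m+2+2k = trans n≡m+2k+2 (two-more m k)
  last-index : n ∸ 2 ∸ 2 ℕ.* k ≡ m
  last-index = trans (cong (λ j → j ∸ 2 ∸ 2 ℕ.* k) n≡m+2+2k) (m+n∸n≡m m (2 ℕ.* k))
  -- y^k times the key identity for m
  shifted-identity : Y₂ + Y₀ ≡ + m * Yf
  shifted-identity = trans (cong (_+_ Y₂) (sym (yPow-y-comm k (F′ m) a b)))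
                           (map-identity {c = + m} {r = F m} (yPow-linear k) (key-identity m) a b)

expansion : ∀ r k n → F′ r ≈P 0P → n ≡ r ℕ.+ 2 ℕ.* k → F′ n ≈P sumP k (term n)
expansion r k n F′r≈0 n≡r+2k a b = begin
  F′ n a b                                 ≡⟨ telescope r k n n≡r+2k a b ⟩
  S + (-1ℤ ^ k) * yPow* k (F′ r) a b       ≡⟨ cong (λ u → S + (-1ℤ ^ k) * u)
                                                   (maps-zero (yPow-linear k) F′r≈0 a b) ⟩
  S + (-1ℤ ^ k) * 0ℤ                       ≡⟨ cong (_+_ S) (ℤP.*-zeroʳ (-1ℤ ^ k)) ⟩
  S + 0ℤ                                   ≡⟨ ℤP.+-identityʳ S ⟩
  S                                        ∎
  where
  S : ℤ
  S = sumP k (term n) a b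

odd-or-even : ∀ m → 3 ℕ.+ m ≡ 1 ℕ.+ 2 ℕ.* suc ⌊ m /2⌋ ⊎ 3 ℕ.+ m ≡ 2 ℕ.+ 2 ℕ.* suc ⌊ m /2⌋
odd-or-even zero          = inj₁ refl
odd-or-even (suc zero)    = inj₂ refl
odd-or-even (suc (suc m)) = Sum.map (add-two 1) (add-two 2) (odd-or-even m)
  where
  add-two : ∀ r → 3 ℕ.+ m ≡ r ℕ.+ 2 ℕ.* suc ⌊ m /2⌋ →
            5 ℕ.+ m ≡ r ℕ.+ 2 ℕ.* suc (suc ⌊ m /2⌋)
  add-two r e = trans (cong (2 ℕ.+_) e) (sym (two-more r (suc ⌊ m /2⌋)))

mainTheorem3 : (n : ℕ) → 3 ≤ n →
    ∂y (F n) ≈P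
      sumP (suc ⌊ n ∸ 3 /2⌋)
        (λ i → ((-1ℤ ^ i) * (+ (n ∸ 2 ∸ 2 ℕ.* i))) ·P yPow* i (F (n ∸ 2 ∸ 2 ℕ.* i)))
mainTheorem3 (suc (suc (suc m))) (s≤s (s≤s (s≤s z≤n))) with odd-or-even m
... | inj₁ n≡1+2k = expansion 1 (suc ⌊ m /2⌋) (3 ℕ.+ m) F′-1 n≡1+2k
... | inj₂ n≡2+2k = expansion 2 (suc ⌊ m /2⌋) (3 ℕ.+ m) F′-2 n≡2+2k
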